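{- Let $i,j$ be integers with $0\leq i\leq j$ and $j\geq 1$. For any connected graph $G$, $\gamma_{i/j}(G)\leq \lceil (i/j)\,\gamma(G)\rceil$.
   Context: All graphs are finite and simple. For a graph $G=(V,E)$ and $v\in V$, $N[v]=\{v\}\cup\{u : uv\in E\}$, and for $S\subseteq V$, $N[S]=\bigcup_{u\in S}N[u]$. A set $S$ is dominating if $N[S]=V$, and $\gamma(G)$ is the minimum cardinality of a dominating set. For $p\in[0,1]$, a set $S\subseteq V$ is a $p$-dominating set if $|N[S]|/|V|\geq p$; $\gamma_p(G)$ is the minimum cardinality of a $p$-dominating set of $G$. -}

module Defs where

open import Data.Nat using (ℕ; suc; _+_; _*_; _∸_; _≤_; _/_; NonZero)
open import Data.Bool using (Bool; true; false; T)
open import Data.Fin using (Fin)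
open import Data.Fin.Subset using (Subset; _∈_; ∣_∣; ⊤)
open import Data.Vec using (tabulate)
open import Data.Product using (Σ; ∃; _×_; _,_)
open import Data.List using (List; []; _∷_)
open import Relation.Binary.PropositionalEquality using (_≡_)
open import Relation.Nullary using (¬_)

record Graph (n : ℕ) : Set where
  field
    adj   : Fin n → Fin n → Bool
    sym   : ∀ u v → adj u v ≡ adj v u
    irrefl : ∀ v → adj v v ≡ false
open Graph public

data Walk {n : ℕ} (G : Graph n) : Fin n → Fin n → Set where
  here : ∀ {v} → Walk G v v
  step : ∀ {u w v} → T (adj G u w) → Walk G w v → Walk G u v

Connected : {n : ℕ} → Graph n → Set
Connected {n} G = Fin n × (∀ u v → Walk G u v)

closedNbhd : {n : ℕ} → Graph n → Subset n → Subset n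
closedNbhd {n} G S = tabulate λ v → anyFin (λ u → lookupB u ∧ (isV u v ∨ adj G u v))
  where
    open import Data.Bool using (_∧_; _∨_)
    open import Data.Vec using (lookup)
    open import Data.Fin using (_≟_)
    open import Relation.Nullary.Decidable using (⌊_⌋)
    open import Data.Fin.Properties using (any?)
    lookupB : Fin n → Bool
    lookupB u = lookup S u
    isV : Fin n → Fin n → Bool
    isV u v = ⌊ u ≟ v ⌋
    anyFin : (Fin n → Bool) → Bool
    anyFin f = ⌊ any? (λ u → Data.Bool._≟_ (f u) true) ⌋
      where import Data.Bool

Dominating : {n : ℕ} → Graph n → Subset n → Set
Dominating G S = closedNbhd G S ≡ ⊤

-- S is (i/j)-dominating: |N[S]| / |V| ≥ i / j, i.e. j·|N[S]| ≥ i·|V|.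
PDominating : {n : ℕ} → Graph n → (i j : ℕ) → Subset n → Set
PDominating {n} G i j S = i * n ≤ j * ∣ closedNbhd G S ∣

IsDominationNumber : {n : ℕ} → Graph n → ℕ → Set
IsDominationNumber G k =
  Σ _ (λ S → Dominating G S × ∣ S ∣ ≡ k) × (∀ S → Dominating G S → k ≤ ∣ S ∣)

IsPDominationNumber : {n : ℕ} → Graph n → (i j : ℕ) → ℕ → Set
IsPDominationNumber G i j m =
  Σ _ (λ S → PDominating G i j S × ∣ S ∣ ≡ m) × (∀ S → PDominating G i j S → m ≤ ∣ S ∣)

ceilDiv : (a j : ℕ) → .{{_ : NonZero j}} → ℕ
ceilDiv a j = (a + (j ∸ 1)) / j

-- Let D be a minimum dominating set, |D| = k, and send every vertex to a
-- vertex of D dominating it.  This splits V into k classes, one per vertex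
-- of D.  Averaging shows that some t = ⌈ik/j⌉ ≤ k vertices of D carry at
-- least t/k ≥ i/j of all vertices in their classes, and every vertex of such
-- a class lies in the closed neighbourhood of those t vertices.
module Submission where

open import Defs hiding (sym)
open import Data.Bool using (true; false; _∧_; _∨_; if_then_else_)
open import Data.Bool.Properties using (T-≡)
open import Data.Fin using (Fin; zero; suc; _≟_)
open import Data.Fin.Subset using (Subset; _∈_; _⊆_; ∣_∣; ⊤; ⊥; ⁅_⁆)
open import Data.Fin.Subset.Properties using (∣⊥∣≡0; ∣⊤∣≡n; ∈⊤; ∣p∣≤∣x∷p∣; p⊆q⇒∣p∣≤∣q∣)
open import Data.Nat using (ℕ; zero; suc; _+_; _*_; _≤_; _<_; z≤n; s≤s; NonZero; >-nonZero; _%_)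
open import Data.Nat.DivMod using (m≡m%n+[m/n]*n; m%n<n; m<n*o⇒m/o<n)
open import Data.Nat.Properties hiding (_≟_)
open import Algebra.Properties.CommutativeSemigroup +-commutativeSemigroup
  using () renaming (interchange to +-interchange)
open import Data.Nat.Solver using (module +-*-Solver)
open import Data.Product using (∃; _×_; _,_; proj₁; proj₂)
open import Data.Sum using (inj₁; inj₂)
open import Data.Vec using ([]; _∷_; lookup; tabulate; here; there)
open import Data.Vec.Properties using (lookup∘tabulate; lookup-replicate; []=⇒lookup; lookup⇒[]=)
open import Function using (_∘_; Equivalence)
open import Relation.Binary.PropositionalEquality
open import Relation.Nullary.Decidable using (⌊_⌋; toWitness; fromWitness)

open +-*-Solver using (solve; _:+_; _:*_; _:=_; con)

*-cross-≤-trans : ∀ {a b c d e f} .{{_ : NonZero d}} →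
                  a * d ≤ b * c → c * f ≤ d * e → a * f ≤ b * e
*-cross-≤-trans {a} {b} {c} {d} {e} {f} ad≤bc cf≤de = *-cancelʳ-≤ (a * f) (b * e) d (begin
  a * f * d   ≡⟨ solve 3 (λ a d f → a :* f :* d := a :* d :* f) refl a d f ⟩
  a * d * f   ≤⟨ *-monoˡ-≤ f ad≤bc ⟩
  b * c * f   ≡⟨ *-assoc b c f ⟩
  b * (c * f) ≤⟨ *-monoʳ-≤ b cf≤de ⟩
  b * (d * e) ≡⟨ solve 3 (λ b d e → b :* (d :* e) := b :* e :* d) refl b d e ⟩
  b * e * d   ∎)
  where open ≤-Reasoning

≤-*-ceilDiv : ∀ a j .{{_ : NonZero j}} → a ≤ j * ceilDiv a j
≤-*-ceilDiv a (suc j) = +-cancelʳ-≤ j a _ (begin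
  a + j                           ≡⟨ m≡m%n+[m/n]*n (a + j) (suc j) ⟩
  (a + j) % suc j + q * suc j     ≤⟨ +-monoˡ-≤ _ (≤-pred (m%n<n (a + j) (suc j))) ⟩
  j + q * suc j                   ≡⟨ solve 2 (λ j q → j :+ q :* (con 1 :+ j) := (con 1 :+ j) :* q :+ j) refl j q ⟩
  suc j * q + j                   ∎)
  where
  open ≤-Reasoning
  q : ℕ
  q = ceilDiv a (suc j)

ceilDiv-*-≤ : ∀ {i j} k .{{_ : NonZero j}} → i ≤ j → ceilDiv (i * k) j ≤ k
ceilDiv-*-≤ {i} {suc j} k i≤j = ≤-pred (m<n*o⇒m/o<n (begin-strict
  i * k + j         ≤⟨ +-monoˡ-≤ j (*-monoˡ-≤ k i≤j) ⟩
  suc j * k + j     <⟨ +-monoʳ-< (suc j * k) (n<1+n j) ⟩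
  suc j * k + suc j ≡⟨ solve 2 (λ j k → j :* k :+ j := (con 1 :+ k) :* j) refl (suc j) k ⟩
  suc k * suc j     ∎))
  where open ≤-Reasoning

sumOver : ∀ {N} → Subset N → (Fin N → ℕ) → ℕ
sumOver []          w = 0
sumOver (true  ∷ S) w = w zero + sumOver S (w ∘ suc)
sumOver (false ∷ S) w = sumOver S (w ∘ suc)

drop-light : ∀ {K t W S M} .{{_ : NonZero K}} →
             K * W ≤ S → t * S ≤ K * M → t * (W + S) ≤ suc K * M
drop-light {K} {t} {W} {S} {M} KW≤S tS≤KM = *-cancelˡ-≤ K (begin
  K * (t * (W + S))          ≡⟨ solve 4 (λ K t W S → K :* (t :* (W :+ S)) := t :* (K :* W) :+ K :* (t :* S)) refl K t W S ⟩
  t * (K * W) + K * (t * S)  ≤⟨ +-monoˡ-≤ (K * (t * S)) (*-monoʳ-≤ t KW≤S) ⟩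
  suc K * (t * S)            ≤⟨ *-monoʳ-≤ (suc K) tS≤KM ⟩
  suc K * (K * M)            ≡⟨ solve 2 (λ K M → (con 1 :+ K) :* (K :* M) := K :* ((con 1 :+ K) :* M)) refl K M ⟩
  K * (suc K * M)            ∎)
  where open ≤-Reasoning

keep-heavy : ∀ {K t W S M} .{{_ : NonZero K}} →
             t ≤ K → S ≤ K * W → t * S ≤ K * M → suc t * (W + S) ≤ suc K * (W + M)
keep-heavy {_} {t} {W} {S} {M} t≤K S≤KW tS≤KM with m≤n⇒∃[o]m+o≡n t≤K
... | a , refl = *-cancelˡ-≤ (t + a) (begin
  K * (suc t * (W + S))
    ≡⟨ solve 4 (λ t a W S → let K = t :+ a in
                 K :* ((con 1 :+ t) :* (W :+ S)) := K :* (con 1 :+ t) :* W :+ a :* S :+ (con 1 :+ K) :* (t :* S))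
               refl t a W S ⟩
  K * suc t * W + a * S + suc K * (t * S)
    ≤⟨ +-mono-≤ (+-monoʳ-≤ (K * suc t * W) (*-monoʳ-≤ a S≤KW)) (*-monoʳ-≤ (suc K) tS≤KM) ⟩
  K * suc t * W + a * (K * W) + suc K * (K * M)
    ≡⟨ solve 4 (λ t a W M → let K = t :+ a in
                 K :* (con 1 :+ t) :* W :+ a :* (K :* W) :+ (con 1 :+ K) :* (K :* M) := K :* ((con 1 :+ K) :* (W :+ M)))
               refl t a W M ⟩
  K * (suc K * (W + M)) ∎)
  where
  open ≤-Reasoning
  K : ℕ
  K = t + a

-- A point of D is left out when its weight is at most the average of the
-- remaining points (K * W ≤ S) and taken otherwise.
above-average-subset : ∀ {N} (D : Subset N) (w : Fin N → ℕ) {t} → t ≤ ∣ D ∣ →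
                       ∃ λ S → ∣ S ∣ ≡ t × t * sumOver D w ≤ ∣ D ∣ * sumOver S w
above-average-subset [] w z≤n = [] , refl , z≤n
above-average-subset (false ∷ D) w t≤∣D∣ with above-average-subset D (w ∘ suc) t≤∣D∣
... | S , ∣S∣≡t , avg = false ∷ S , ∣S∣≡t , avg
above-average-subset {suc N} (true ∷ D) w {zero} _ = ⊥ , ∣⊥∣≡0 (suc N) , z≤n
above-average-subset (true ∷ D) w {suc t} (s≤s t≤K) with m≤n⇒m<n∨m≡n t≤K
... | inj₂ refl = true ∷ D , refl , ≤-refl
... | inj₁ t<K with ≤-total (∣ D ∣ * w zero) (sumOver D (w ∘ suc))
...   | inj₁ light with above-average-subset D (w ∘ suc) t<K
...     | S , ∣S∣≡t , avg = false ∷ S , ∣S∣≡t , drop-light {t = suc t} {{>-nonZero (m<n⇒0<n t<K)}} light avg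
above-average-subset (true ∷ D) w {suc t} (s≤s t≤K) | inj₁ t<K | inj₂ heavy
  with above-average-subset D (w ∘ suc) (<⇒≤ t<K)
... | S , ∣S∣≡t , avg = true ∷ S , cong suc ∣S∣≡t , keep-heavy {{>-nonZero (m<n⇒0<n t<K)}} (<⇒≤ t<K) heavy avg

preimage : ∀ {n N} → (Fin n → Fin N) → Subset N → Subset n
preimage f S = tabulate (λ v → lookup S (f v))

∈-preimage⁺ : ∀ {n N} {f : Fin n → Fin N} {S x} → f x ∈ S → x ∈ preimage f S
∈-preimage⁺ {f = f} {S} {x} fx∈S = lookup⇒[]= x _ (trans (lookup∘tabulate _ x) ([]=⇒lookup fx∈S))

∈-preimage⁻ : ∀ {n N} {f : Fin n → Fin N} {S x} → x ∈ preimage f S → f x ∈ S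
∈-preimage⁻ {f = f} {S} {x} x∈ = lookup⇒[]= (f x) S (trans (sym (lookup∘tabulate _ x)) ([]=⇒lookup x∈))

∣∷∣ : ∀ {n} b (p : Subset n) → ∣ b ∷ p ∣ ≡ (if b then 1 else 0) + ∣ p ∣
∣∷∣ true  p = refl
∣∷∣ false p = refl

sumOver-cong : ∀ {N} (S : Subset N) {w w′ : Fin N → ℕ} → (∀ x → w x ≡ w′ x) → sumOver S w ≡ sumOver S w′
sumOver-cong []          w≗w′ = refl
sumOver-cong (true  ∷ S) w≗w′ = cong₂ _+_ (w≗w′ zero) (sumOver-cong S (w≗w′ ∘ suc))
sumOver-cong (false ∷ S) w≗w′ = sumOver-cong S (w≗w′ ∘ suc)

sumOver-+ : ∀ {N} (S : Subset N) (v w : Fin N → ℕ) → sumOver S (λ x → v x + w x) ≡ sumOver S v + sumOver S w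
sumOver-+ []          v w = refl
sumOver-+ (true  ∷ S) v w = trans (cong (v zero + w zero +_) (sumOver-+ S (v ∘ suc) (w ∘ suc)))
                                  (+-interchange (v zero) (w zero) _ _)
sumOver-+ (false ∷ S) v w = sumOver-+ S (v ∘ suc) (w ∘ suc)

sumOver-zero : ∀ {N} (S : Subset N) → sumOver S (λ _ → 0) ≡ 0
sumOver-zero []          = refl
sumOver-zero (true  ∷ S) = sumOver-zero S
sumOver-zero (false ∷ S) = sumOver-zero S

sumOver-⁅⁆ : ∀ {N} (S : Subset N) y →
             sumOver S (λ x → if lookup ⁅ x ⁆ y then 1 else 0) ≡ (if lookup S y then 1 else 0)
sumOver-⁅⁆ (true  ∷ S) zero    = cong suc (sumOver-zero S)
sumOver-⁅⁆ (false ∷ S) zero    = sumOver-zero S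
sumOver-⁅⁆ (true  ∷ S) (suc y) rewrite lookup-replicate y false = sumOver-⁅⁆ S y
sumOver-⁅⁆ (false ∷ S) (suc y) = sumOver-⁅⁆ S y

fibreSize : ∀ {n N} → (Fin n → Fin N) → Fin N → ℕ
fibreSize f x = ∣ preimage f ⁅ x ⁆ ∣

sumOver-fibres : ∀ {n N} (S : Subset N) (f : Fin n → Fin N) →
                 sumOver S (fibreSize f) ≡ ∣ preimage f S ∣
sumOver-fibres {zero}  S f = sumOver-zero S
sumOver-fibres {suc n} S f = begin
  sumOver S (fibreSize f)
    ≡⟨ sumOver-cong S (λ x → ∣∷∣ (lookup ⁅ x ⁆ (f zero)) (preimage (f ∘ suc) ⁅ x ⁆)) ⟩
  sumOver S (λ x → (if lookup ⁅ x ⁆ (f zero) then 1 else 0) + ∣ preimage (f ∘ suc) ⁅ x ⁆ ∣)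
    ≡⟨ sumOver-+ S _ _ ⟩
  sumOver S (λ x → if lookup ⁅ x ⁆ (f zero) then 1 else 0) + sumOver S (fibreSize (f ∘ suc))
    ≡⟨ cong₂ _+_ (sumOver-⁅⁆ S (f zero)) (sumOver-fibres S (f ∘ suc)) ⟩
  (if lookup S (f zero) then 1 else 0) + ∣ preimage (f ∘ suc) S ∣
    ≡⟨ sym (∣∷∣ (lookup S (f zero)) (preimage (f ∘ suc) S)) ⟩
  ∣ preimage f S ∣ ∎
  where open ≡-Reasoning

x∈p⇒0<∣p∣ : ∀ {n} {p : Subset n} {x} → x ∈ p → 0 < ∣ p ∣
x∈p⇒0<∣p∣ here        = s≤s z≤n
x∈p⇒0<∣p∣ {p = b ∷ p} (there x∈p) = ≤-trans (x∈p⇒0<∣p∣ x∈p) (∣p∣≤∣x∷p∣ b p)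

Covers : ∀ {n} → Graph n → Fin n → Fin n → Set
Covers G u v = (⌊ u ≟ v ⌋ ∨ adj G u v) ≡ true

∧-≡-true : ∀ {a b} → (a ∧ b) ≡ true → a ≡ true × b ≡ true
∧-≡-true {true} b≡true = refl , b≡true

∈-closedNbhd⁺ : ∀ {n} (G : Graph n) {S u v} → u ∈ S → Covers G u v → v ∈ closedNbhd G S
∈-closedNbhd⁺ G {S} {u} {v} u∈S uv = lookup⇒[]= v _ (trans (lookup∘tabulate _ v)
  (Equivalence.to T-≡ (fromWitness (u , trans (cong (_∧ _) ([]=⇒lookup u∈S)) uv))))

∈-closedNbhd⁻ : ∀ {n} (G : Graph n) {S v} → v ∈ closedNbhd G S → ∃ λ u → u ∈ S × Covers G u v
∈-closedNbhd⁻ G {S} {v} v∈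
  with toWitness (Equivalence.from T-≡ (trans (sym (lookup∘tabulate _ v)) ([]=⇒lookup v∈)))
... | u , Su∧uv with ∧-≡-true Su∧uv
... | u∈S , uv = u , lookup⇒[]= u S u∈S , uv

dominator : ∀ {n} (G : Graph n) {D} → Dominating G D → (v : Fin n) → ∃ λ u → u ∈ D × Covers G u v
dominator G {D} dom v = ∈-closedNbhd⁻ G {D} (subst (v ∈_) (sym dom) ∈⊤)

dominating⇒large-closedNbhd : ∀ {n} (G : Graph n) {D t} → Dominating G D → t ≤ ∣ D ∣ →
                               ∃ λ S → ∣ S ∣ ≡ t × t * n ≤ ∣ D ∣ * ∣ closedNbhd G S ∣
dominating⇒large-closedNbhd {n} G {D} {t} dom t≤∣D∣
  with above-average-subset D (fibreSize (proj₁ ∘ dominator G {D} dom)) t≤∣D∣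
... | S , ∣S∣≡t , average = S , ∣S∣≡t , (begin
  t * n                           ≡⟨ cong (t *_) (sym (∣⊤∣≡n n)) ⟩
  t * ∣ ⊤ {n} ∣                   ≤⟨ *-monoʳ-≤ t (p⊆q⇒∣p∣≤∣q∣ {p = ⊤ {n}} ⊤⊆d⁻¹D) ⟩
  t * ∣ preimage d D ∣            ≡⟨ cong (t *_) (sym (sumOver-fibres D d)) ⟩
  t * sumOver D (fibreSize d)     ≤⟨ average ⟩
  ∣ D ∣ * sumOver S (fibreSize d) ≡⟨ cong (∣ D ∣ *_) (sumOver-fibres S d) ⟩
  ∣ D ∣ * ∣ preimage d S ∣        ≤⟨ *-monoʳ-≤ ∣ D ∣ (p⊆q⇒∣p∣≤∣q∣ {p = preimage d S} (d⁻¹⊆N S)) ⟩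
  ∣ D ∣ * ∣ closedNbhd G S ∣      ∎)
  where
  open ≤-Reasoning
  d : Fin n → Fin n
  d v = proj₁ (dominator G {D} dom v)
  ⊤⊆d⁻¹D : ⊤ {n} ⊆ preimage d D
  ⊤⊆d⁻¹D {v} _ = ∈-preimage⁺ {f = d} (proj₁ (proj₂ (dominator G {D} dom v)))
  d⁻¹⊆N : ∀ S → preimage d S ⊆ closedNbhd G S
  d⁻¹⊆N S {v} v∈ = ∈-closedNbhd⁺ G {S} (∈-preimage⁻ {f = d} v∈) (proj₂ (proj₂ (dominator G {D} dom v)))

theorem3p4 : (i j : ℕ) → .{{_ : NonZero j}} → i ≤ j →
    {n : ℕ} → (G : Graph n) → Connected G →
    (k m : ℕ) → IsDominationNumber G k → IsPDominationNumber G i j m →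
    m ≤ ceilDiv (i * k) j
theorem3p4 i j i≤j G (v , _) k m ((D , dom , refl) , _) (_ , minimal)
  with dominating⇒large-closedNbhd G {D} dom (ceilDiv-*-≤ ∣ D ∣ i≤j)
... | S , ∣S∣≡t , large = ≤-trans (minimal S pDominating) (≤-reflexive ∣S∣≡t)
  where
  -- Connectedness is needed only for a vertex v, which makes γ(G) positive.
  instance
    ∣D∣≢0 : NonZero ∣ D ∣
    ∣D∣≢0 = >-nonZero (x∈p⇒0<∣p∣ {p = D} (proj₁ (proj₂ (dominator G {D} dom v))))
  pDominating : PDominating G i j S
  pDominating = *-cross-≤-trans {i} {j} {ceilDiv (i * ∣ D ∣) j} {∣ D ∣} (≤-*-ceilDiv (i * ∣ D ∣) j) large
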